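{- Let $L$ be a three-dimensional lattice, $f : L \to L$, $s = (*,*,s_3)$ a principal slice, and $a \preceq b$ points such that $L_{a,b}$ satisfies the invariant. Then one of the following exists: (i) a point $x \in L_{a,b}$ such that $x \in \mathrm{Up}(f)$ or $x \in \mathrm{Down}(f)$; (ii) two points $x, y \in L_{a,b}$ that witness a violation of order preservation of $f$.
   Context: $L = L(n_1,n_2,n_3)$ is the set of $x \in \mathbb{N}^3$ with $1 \le x_i \le n_i$, ordered by $x \preceq y$ iff $x_i \le y_i$ for all $i$; $L_{a,b} = \{c \in L : a \preceq c \preceq b\}$. $\mathrm{Up}(f)=\{x : x \preceq f(x)\}$, $\mathrm{Down}(f)=\{x : f(x)\preceq x\}$. $L_s = \{x \in L : x_3 = s_3\}$; $f_s : L_s \to L_s$ with $f_s(x)_i = f(x)_i$ for $i\in\{1,2\}$ and $f_s(x)_3 = s_3$; $\mathrm{Up}(f_s) = \{x\in L_s : x \preceq f_s(x)\}$, $\mathrm{Down}(f_s) = \{x\in L_s : f_s(x) \preceq x\}$. Points $x,y$ witness a violation of order preservation if $x\preceq y$ and $f(x)\not\preceq f(y)$. A down set witness is a pair $(d,b)$ with $d,b \in L_s$, $d_3 \le f(d)_3$, $b_3 \le f(b)_3$, and $i\ne j \in\{1,2\}$ with $d_i=b_i$, $d_j\le b_j$, $d_j \le f(d)_j$, $f(b)_j \le b_j$. An up set witness is a pair $(a,u)$ with $a,u\in L_s$, $a_3 \ge f(a)_3$, $u_3 \ge f(u)_3$, and $i\ne j\in\{1,2\}$ with $a_i=u_i$,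 $u_j\ge a_j$, $u_j \ge f(u)_j$, $f(a)_j\ge a_j$. The sub-instance $L_{a,b}$ satisfies the invariant if: either $a \in \mathrm{Up}(f_s)$ or there is an up set witness $(a,u)$ with $u \preceq b$; and either $b \in \mathrm{Down}(f_s)$ or there is a down set witness $(d,b)$ with $a \preceq d$; and if both an up set witness $(a,u)$ and a down set witness $(d,b)$ are used, then $u \preceq d$. -}

module Defs where

open import Data.Nat using (ℕ; _≤_)
open import Data.Fin using (Fin; zero; suc)
open import Data.Product using (Σ; _×_; _,_; proj₁)
open import Data.Sum using (_⊎_; inj₁; inj₂)
open import Data.Unit using (⊤)
open import Relation.Binary.PropositionalEquality using (_≡_; _≢_)
open import Relation.Nullary using (¬_)

Point : Set
Point = Fin 3 → ℕ

c₁ c₂ c₃ : Fin 3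
c₁ = zero
c₂ = suc zero
c₃ = suc (suc zero)

_⪯_ : Point → Point → Set
x ⪯ y = ∀ i → x i ≤ y i

InL : (n : Fin 3 → ℕ) → Point → Set
InL n x = ∀ i → 1 ≤ x i × x i ≤ n i

L : (n : Fin 3 → ℕ) → Set
L n = Σ Point (InL n)

pt : ∀ {n} → L n → Point
pt (x , _) = x

module Lattice (n : Fin 3 → ℕ) (f : L n → L n) (s₃ : ℕ) where

  F : L n → Point
  F x = pt (f x)

  Up : L n → Set
  Up x = pt x ⪯ F x

  Down : L n → Set
  Down x = F x ⪯ pt x

  InSlice : L n → Set
  InSlice x = pt x c₃ ≡ s₃

  Fs : L n → Point
  Fs x zero = F x c₁
  Fs x (suc zero) = F x c₂
  Fs x (suc (suc zero)) = s₃

  Up-s : L n → Set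
  Up-s x = InSlice x × pt x ⪯ Fs x

  Down-s : L n → Set
  Down-s x = InSlice x × Fs x ⪯ pt x

  TwoDims : (Fin 3 → Fin 3 → Set) → Set
  TwoDims P = Σ (Fin 3) λ i → Σ (Fin 3) λ j → i ≢ c₃ × j ≢ c₃ × i ≢ j × P i j

  DownWitness : L n → L n → Set
  DownWitness d b =
    InSlice d × InSlice b × pt d c₃ ≤ F d c₃ × pt b c₃ ≤ F b c₃ ×
    TwoDims (λ i j → pt d i ≡ pt b i × pt d j ≤ pt b j × pt d j ≤ F d j × F b j ≤ pt b j)

  UpWitness : L n → L n → Set
  UpWitness a u =
    InSlice a × InSlice u × F a c₃ ≤ pt a c₃ × F u c₃ ≤ pt u c₃ ×
    TwoDims (λ i j → pt a i ≡ pt u i × pt a j ≤ pt u j × F u j ≤ pt u j × pt a j ≤ F a j)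

  InvUp : L n → L n → Set
  InvUp a b = Up-s a ⊎ Σ (L n) (λ u → UpWitness a u × pt u ⪯ pt b)

  InvDown : L n → L n → Set
  InvDown a b = Down-s b ⊎ Σ (L n) (λ d → DownWitness d b × pt a ⪯ pt d)

  Compat : ∀ {a b} → InvUp a b → InvDown a b → Set
  Compat (inj₂ (u , _)) (inj₂ (d , _)) = pt u ⪯ pt d
  Compat _ _ = ⊤

  Invariant : L n → L n → Set
  Invariant a b = Σ (InvUp a b) λ p → Σ (InvDown a b) λ q → Compat p q

  InBox : L n → L n → L n → Set
  InBox a b x = pt a ⪯ pt x × pt x ⪯ pt b

  Violation : L n → L n → Set
  Violation x y = pt x ⪯ pt y × ¬ (F x ⪯ F y)

-- Every point of L_{a,b} lies in the slice x₃ = s₃, and f may be assumed order preserving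
-- on L_{a,b}, since any failure is a violation.  Under that assumption a Tarski iteration
-- works coordinatewise: if x ⪯ y, x ⪯ f(x) on a set S of coordinates and f(y) ⪯ y on S,
-- then overwriting the S-coordinates of x by those of f(x) climbs strictly while staying
-- below y, so it stops at a point fixed on S (dually, descending from y above x).
-- A one-coordinate iteration along a witness segment turns an up set witness into a point
-- of Up in coordinates 1, 2 (or a point of Down(f)), and a down set witness into a point of
-- Down in coordinates 1, 2 (or of Up(f)); the last clause of the invariant keeps the first
-- below the second.  Iterating in coordinates 1, 2 between them ends at a point fixed in
-- those coordinates, which is in Up(f) or Down(f) according to its third coordinate.

module Submission where

open import Defs
open import Data.Nat using (ℕ; _≤_; _<_; _+_; _∸_; _≤?_)
open import Data.Nat.Properties
  using (≤-refl; ≤-trans; ≤-reflexive; ≤-antisym; ≤-total; ≰⇒>; +-mono-≤; +-mono-<-≤; +-mono-≤-<; ∸-monoʳ-<)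
open import Data.Nat.Induction using (<-wellFounded)
open import Data.Fin using (Fin; zero; suc; _≟_)
open import Data.Fin.Properties using (all?; ¬∀⟶∃¬)
open import Data.Product using (Σ; _×_; _,_; proj₁; proj₂)
open import Data.Sum using (_⊎_; inj₁; inj₂; assocˡ; reduce)
import Data.Sum.Effectful.Left as SumLeft
open import Data.Empty using (⊥-elim)
open import Effect.Monad using (RawMonad)
open import Function using (_∘_; case_of_)
open import Induction.WellFounded using (Acc; acc)
open import Level using (0ℓ)
open import Relation.Binary.PropositionalEquality using (_≡_; _≢_; refl; sym; trans; subst)
open import Relation.Nullary using (¬_; Dec; yes; no; ¬?)
open import Relation.Unary using (Pred; Decidable)

iterateDecreasing : {A R : Set} (P : A → Set) (μ : A → ℕ) →
  (∀ x → P x → R ⊎ Σ A λ x' → P x' × μ x' < μ x) → ∀ x → P x → R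
iterateDecreasing {A} {R} P μ step x = go x (<-wellFounded (μ x))
  where
  go : ∀ x → Acc _<_ (μ x) → P x → R
  go x (acc rs) px with step x px
  ... | inj₁ r = r
  ... | inj₂ (x' , px' , μx'<μx) = go x' (rs μx'<μx) px'

⪯-refl : ∀ {p} → p ⪯ p
⪯-refl _ = ≤-refl

⪯-trans : ∀ {p q r} → p ⪯ q → q ⪯ r → p ⪯ r
⪯-trans p⪯q q⪯r k = ≤-trans (p⪯q k) (q⪯r k)

_⪯?_ : (p q : Point) → Dec (p ⪯ q)
p ⪯? q = all? (λ k → p k ≤? q k)

sum : Point → ℕ
sum p = p c₁ + p c₂ + p c₃

sum-mono : ∀ {p q} → p ⪯ q → sum p ≤ sum q
sum-mono p⪯q = +-mono-≤ (+-mono-≤ (p⪯q c₁) (p⪯q c₂)) (p⪯q c₃)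

sum-mono-< : ∀ {p q} → p ⪯ q → ¬ q ⪯ p → sum p < sum q
sum-mono-< {p} {q} p⪯q q⋠p with ¬∀⟶∃¬ 3 _ (λ k → q k ≤? p k) q⋠p
... | zero , q₁≰p₁ = +-mono-<-≤ (+-mono-<-≤ (≰⇒> q₁≰p₁) (p⪯q c₂)) (p⪯q c₃)
... | suc zero , q₂≰p₂ = +-mono-<-≤ (+-mono-≤-< (p⪯q c₁) (≰⇒> q₂≰p₂)) (p⪯q c₃)
... | suc (suc zero) , q₃≰p₃ = +-mono-≤-< (+-mono-≤ (p⪯q c₁) (p⪯q c₂)) (≰⇒> q₃≰p₃)

Planar : Pred (Fin 3) 0ℓ
Planar k = k ≢ c₃

planar? : Decidable Planar
planar? k = ¬? (k ≟ c₃)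

planar-cases : {P : Fin 3 → Set} {i j : Fin 3} → i ≢ c₃ → j ≢ c₃ → i ≢ j →
  P i → P j → P c₃ → ∀ k → P k
planar-cases {i = zero} {zero} _ _ i≢j _ _ _ _ = ⊥-elim (i≢j refl)
planar-cases {i = zero} {suc zero} _ _ _ p₁ _ _ zero = p₁
planar-cases {i = zero} {suc zero} _ _ _ _ p₂ _ (suc zero) = p₂
planar-cases {i = suc zero} {zero} _ _ _ _ p₁ _ zero = p₁
planar-cases {i = suc zero} {zero} _ _ _ p₂ _ _ (suc zero) = p₂
planar-cases {i = suc zero} {suc zero} _ _ i≢j _ _ _ _ = ⊥-elim (i≢j refl)
planar-cases {i = suc (suc zero)} i≢3 _ _ _ _ _ _ = ⊥-elim (i≢3 refl)
planar-cases {j = suc (suc zero)} _ j≢3 _ _ _ _ _ = ⊥-elim (j≢3 refl)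
planar-cases _ _ _ _ _ p₃ (suc (suc zero)) = p₃

module _ {S : Pred (Fin 3) 0ℓ} (S? : Decidable S) where

  replaceOn : Point → Point → Point
  replaceOn p q k with S? k
  ... | yes _ = q k
  ... | no _ = p k

  replaceOn-∈ : ∀ p q {k} → S k → replaceOn p q k ≡ q k
  replaceOn-∈ p q {k} k∈S with S? k
  ... | yes _ = refl
  ... | no k∉S = ⊥-elim (k∉S k∈S)

  replaceOn-⪯ : ∀ {p q r} → p ⪯ r → (∀ k → S k → q k ≤ r k) → replaceOn p q ⪯ r
  replaceOn-⪯ p⪯r q≤r k with S? k
  ... | yes k∈S = q≤r k k∈S
  ... | no _ = p⪯r k

  ⪯-replaceOn : ∀ {p q r} → r ⪯ p → (∀ k → S k → r k ≤ q k) → r ⪯ replaceOn p q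
  ⪯-replaceOn r⪯p r≤q k with S? k
  ... | yes k∈S = r≤q k k∈S
  ... | no _ = r⪯p k

  replaceOn-InL : ∀ {m p q} → InL m p → InL m q → InL m (replaceOn p q)
  replaceOn-InL p∈L q∈L k with S? k
  ... | yes _ = q∈L k
  ... | no _ = p∈L k

module Box (n : Fin 3 → ℕ) (f : L n → L n) (s₃ : ℕ) (a b : L n)
           (a∈s : pt a c₃ ≡ s₃) (b∈s : pt b c₃ ≡ s₃) where
  open Lattice n f s₃

  Outcome : Set
  Outcome = (Σ (L n) λ x → InBox a b x × (Up x ⊎ Down x))
          ⊎ (Σ (L n) λ x → Σ (L n) λ y → InBox a b x × InBox a b y × Violation x y)

  -- Outcome ⊎_ as an exception monad: a conclusion reached midway ends the argument.
  open RawMonad (SumLeft.monad Outcome 0ℓ)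

  UpOn DownOn FixedOn : Pred (Fin 3) 0ℓ → L n → Set
  UpOn S x = ∀ k → S k → pt x k ≤ F x k
  DownOn S x = ∀ k → S k → F x k ≤ pt x k
  FixedOn S x = ∀ k → S k → pt x k ≡ F x k

  inBox-slice : ∀ {x} → InBox a b x → pt x c₃ ≡ s₃
  inBox-slice (a⪯x , x⪯b) =
    ≤-antisym (subst (_ ≤_) b∈s (x⪯b c₃)) (subst (_≤ _) a∈s (a⪯x c₃))

  violation-or-⪯ : ∀ {x y} → InBox a b x → InBox a b y → pt x ⪯ pt y → Outcome ⊎ F x ⪯ F y
  violation-or-⪯ {x} {y} x∈ y∈ x⪯y with F x ⪯? F y
  ... | yes Fx⪯Fy = inj₂ Fx⪯Fy
  ... | no Fx⋠Fy = inj₁ (inj₂ (x , y , x∈ , y∈ , x⪯y , Fx⋠Fy))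

  module _ {S : Pred (Fin 3) 0ℓ} (S? : Decidable S) where

    step : L n → L n
    step x = replaceOn S? (pt x) (F x) , replaceOn-InL S? (proj₂ x) (proj₂ (f x))

    step-⪯⇒FixedOn : ∀ {x} → UpOn S x → pt (step x) ⪯ pt x → FixedOn S x
    step-⪯⇒FixedOn {x} x↑ x'⪯x k k∈S =
      ≤-antisym (x↑ k k∈S) (subst (_≤ pt x k) (replaceOn-∈ S? (pt x) (F x) k∈S) (x'⪯x k))

    step-⪰⇒FixedOn : ∀ {x} → DownOn S x → pt x ⪯ pt (step x) → FixedOn S x
    step-⪰⇒FixedOn {x} x↓ x⪯x' k k∈S =
      ≤-antisym (subst (pt x k ≤_) (replaceOn-∈ S? (pt x) (F x) k∈S) (x⪯x' k)) (x↓ k k∈S)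

    UpOn-step : ∀ {x} → F x ⪯ F (step x) → UpOn S (step x)
    UpOn-step {x} Fx⪯Fx' k k∈S =
      subst (_≤ F (step x) k) (sym (replaceOn-∈ S? (pt x) (F x) k∈S)) (Fx⪯Fx' k)

    DownOn-step : ∀ {x} → F (step x) ⪯ F x → DownOn S (step x)
    DownOn-step {x} Fx'⪯Fx k k∈S =
      subst (F (step x) k ≤_) (sym (replaceOn-∈ S? (pt x) (F x) k∈S)) (Fx'⪯Fx k)

    FixedBelow : L n → L n → Set
    FixedBelow y x = InBox a b x × pt x ⪯ pt y × F x ⪯ F y × FixedOn S x

    FixedAbove : L n → L n → Set
    FixedAbove d y = InBox a b y × pt d ⪯ pt y × F d ⪯ F y × FixedOn S y

    ascend : (y : L n) → InBox a b y → DownOn S y →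
      (x : L n) → InBox a b x → pt x ⪯ pt y → UpOn S x → Outcome ⊎ Σ (L n) (FixedBelow y)
    ascend y y∈ y↓ x x∈ x⪯y x↑ =
      iterateDecreasing Below gap (λ x → assocˡ ∘ climb x) x (x∈ , x⪯y , x↑)
      where
      Below : L n → Set
      Below x = InBox a b x × pt x ⪯ pt y × UpOn S x

      gap : L n → ℕ
      gap x = sum (pt y) ∸ sum (pt x)

      climb : ∀ x → Below x →
        Outcome ⊎ (Σ (L n) (FixedBelow y) ⊎ Σ (L n) λ x' → Below x' × gap x' < gap x)
      climb x (x∈ , x⪯y , x↑) with pt (step x) ⪯? pt x
      ... | yes x'⪯x = do
        Fx⪯Fy ← violation-or-⪯ x∈ y∈ x⪯y
        pure (inj₁ (x , x∈ , x⪯y , Fx⪯Fy , step-⪯⇒FixedOn x↑ x'⪯x))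
      ... | no x'⋠x = do
        Fx⪯Fy ← violation-or-⪯ x∈ y∈ x⪯y
        let x'⪯y = replaceOn-⪯ S? x⪯y (λ k k∈S → ≤-trans (Fx⪯Fy k) (y↓ k k∈S))
            x'∈ = ⪯-trans (proj₁ x∈) x⪯x' , ⪯-trans x'⪯y (proj₂ y∈)
        Fx⪯Fx' ← violation-or-⪯ x∈ x'∈ x⪯x'
        pure (inj₂ (step x , (x'∈ , x'⪯y , UpOn-step Fx⪯Fx') ,
                    ∸-monoʳ-< (sum-mono-< x⪯x' x'⋠x) (sum-mono x'⪯y)))
        where
        x⪯x' : pt x ⪯ pt (step x)
        x⪯x' = ⪯-replaceOn S? ⪯-refl x↑

    descend : (d : L n) → InBox a b d → UpOn S d →
      (y : L n) → InBox a b y → pt d ⪯ pt y → DownOn S y → Outcome ⊎ Σ (L n) (FixedAbove d)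
    descend d d∈ d↑ y y∈ d⪯y y↓ =
      iterateDecreasing Above (sum ∘ pt) (λ y → assocˡ ∘ fall y) y (y∈ , d⪯y , y↓)
      where
      Above : L n → Set
      Above y = InBox a b y × pt d ⪯ pt y × DownOn S y

      fall : ∀ y → Above y →
        Outcome ⊎ (Σ (L n) (FixedAbove d) ⊎ Σ (L n) λ y' → Above y' × sum (pt y') < sum (pt y))
      fall y (y∈ , d⪯y , y↓) with pt y ⪯? pt (step y)
      ... | yes y⪯y' = do
        Fd⪯Fy ← violation-or-⪯ d∈ y∈ d⪯y
        pure (inj₁ (y , y∈ , d⪯y , Fd⪯Fy , step-⪰⇒FixedOn y↓ y⪯y'))
      ... | no y⋠y' = do
        Fd⪯Fy ← violation-or-⪯ d∈ y∈ d⪯y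
        let d⪯y' = ⪯-replaceOn S? d⪯y (λ k k∈S → ≤-trans (d↑ k k∈S) (Fd⪯Fy k))
            y'∈ = ⪯-trans (proj₁ d∈) d⪯y' , ⪯-trans y'⪯y (proj₂ y∈)
        Fy'⪯Fy ← violation-or-⪯ y'∈ y∈ y'⪯y
        pure (inj₂ (step y , (y'∈ , d⪯y' , DownOn-step Fy'⪯Fy) , sum-mono-< y'⪯y y⋠y'))
        where
        y'⪯y : pt (step y) ⪯ pt y
        y'⪯y = replaceOn-⪯ S? ⪯-refl y↓

  FixedOn-planar⇒Up⊎Down : ∀ {x} → FixedOn Planar x → Up x ⊎ Down x
  FixedOn-planar⇒Up⊎Down {x} x-fixed with ≤-total (pt x c₃) (F x c₃)
  ... | inj₁ x₃≤Fx₃ = inj₁ (planar-cases (λ ()) (λ ()) (λ ())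
                              (≤-reflexive (x-fixed c₁ (λ ()))) (≤-reflexive (x-fixed c₂ (λ ()))) x₃≤Fx₃)
  ... | inj₂ Fx₃≤x₃ = inj₂ (planar-cases (λ ()) (λ ()) (λ ())
                              (≤-reflexive (sym (x-fixed c₁ (λ ())))) (≤-reflexive (sym (x-fixed c₂ (λ ())))) Fx₃≤x₃)

  FixedOn-axis⇒UpOn-planar⊎Down : ∀ {i j x} → i ≢ c₃ → j ≢ c₃ → i ≢ j →
    FixedOn (_≡ j) x → F x c₃ ≤ pt x c₃ → UpOn Planar x ⊎ Down x
  FixedOn-axis⇒UpOn-planar⊎Down {i} {j} {x} i≢3 j≢3 i≢j x-fixed Fx₃≤x₃ with ≤-total (pt x i) (F x i)
  ... | inj₁ xᵢ≤Fxᵢ = inj₁ (planar-cases i≢3 j≢3 i≢j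
                              (λ _ → xᵢ≤Fxᵢ) (λ _ → ≤-reflexive (x-fixed j refl)) (λ 3≢3 → ⊥-elim (3≢3 refl)))
  ... | inj₂ Fxᵢ≤xᵢ = inj₂ (planar-cases i≢3 j≢3 i≢j
                              Fxᵢ≤xᵢ (≤-reflexive (sym (x-fixed j refl))) Fx₃≤x₃)

  FixedOn-axis⇒DownOn-planar⊎Up : ∀ {i j x} → i ≢ c₃ → j ≢ c₃ → i ≢ j →
    FixedOn (_≡ j) x → pt x c₃ ≤ F x c₃ → DownOn Planar x ⊎ Up x
  FixedOn-axis⇒DownOn-planar⊎Up {i} {j} {x} i≢3 j≢3 i≢j x-fixed x₃≤Fx₃ with ≤-total (F x i) (pt x i)
  ... | inj₁ Fxᵢ≤xᵢ = inj₁ (planar-cases i≢3 j≢3 i≢j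
                              (λ _ → Fxᵢ≤xᵢ) (λ _ → ≤-reflexive (sym (x-fixed j refl))) (λ 3≢3 → ⊥-elim (3≢3 refl)))
  ... | inj₂ xᵢ≤Fxᵢ = inj₂ (planar-cases i≢3 j≢3 i≢j
                              xᵢ≤Fxᵢ (≤-reflexive (x-fixed j refl)) x₃≤Fx₃)

  UpOn-planar : ∀ {x} → pt x ⪯ Fs x → UpOn Planar x
  UpOn-planar x⪯Fsx zero _ = x⪯Fsx zero
  UpOn-planar x⪯Fsx (suc zero) _ = x⪯Fsx (suc zero)
  UpOn-planar _ (suc (suc zero)) 3≢3 = ⊥-elim (3≢3 refl)

  DownOn-planar : ∀ {x} → Fs x ⪯ pt x → DownOn Planar x
  DownOn-planar Fsx⪯x zero _ = Fsx⪯x zero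
  DownOn-planar Fsx⪯x (suc zero) _ = Fsx⪯x (suc zero)
  DownOn-planar _ (suc (suc zero)) 3≢3 = ⊥-elim (3≢3 refl)

  lowerCeiling : InvUp a b → L n
  lowerCeiling (inj₁ _) = a
  lowerCeiling (inj₂ (u , _)) = u

  upperFloor : InvDown a b → L n
  upperFloor (inj₁ _) = b
  upperFloor (inj₂ (d , _)) = d

  lowerCeiling⪯upperFloor : pt a ⪯ pt b → (p : InvUp a b) (q : InvDown a b) → Compat p q →
    pt (lowerCeiling p) ⪯ pt (upperFloor q)
  lowerCeiling⪯upperFloor a⪯b (inj₁ _) (inj₁ _) _ = a⪯b
  lowerCeiling⪯upperFloor _ (inj₂ (_ , _ , u⪯b)) (inj₁ _) _ = u⪯b
  lowerCeiling⪯upperFloor _ (inj₁ _) (inj₂ (_ , _ , a⪯d)) _ = a⪯d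
  lowerCeiling⪯upperFloor _ (inj₂ _) (inj₂ _) u⪯d = u⪯d

  planarUpBelow : pt a ⪯ pt b → (p : InvUp a b) →
    Outcome ⊎ Σ (L n) λ x → InBox a b x × UpOn Planar x × pt x ⪯ pt (lowerCeiling p)
  planarUpBelow a⪯b (inj₁ (_ , a⪯Fsa)) = pure (a , (⪯-refl , a⪯b) , UpOn-planar a⪯Fsa , ⪯-refl)
  planarUpBelow _ (inj₂ (u , (_ , u∈s , _ , Fu₃≤u₃ , i , j , i≢3 , j≢3 , i≢j ,
                              aᵢ≡uᵢ , aⱼ≤uⱼ , Fuⱼ≤uⱼ , aⱼ≤Faⱼ) , u⪯b)) = do
    (x , x∈ , x⪯u , Fx⪯Fu , x-fixed) ←
      ascend (_≟ j) u u∈ (λ { _ refl → Fuⱼ≤uⱼ }) a (⪯-refl , ⪯-trans a⪯u u⪯b) a⪯u (λ { _ refl → aⱼ≤Faⱼ })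
    let Fx₃≤x₃ = ≤-trans (Fx⪯Fu c₃) (≤-trans Fu₃≤u₃ (≤-reflexive (trans u∈s (sym (inBox-slice {x} x∈)))))
    case FixedOn-axis⇒UpOn-planar⊎Down i≢3 j≢3 i≢j x-fixed Fx₃≤x₃ of λ where
      (inj₁ x↑) → pure (x , x∈ , x↑ , x⪯u)
      (inj₂ x↓) → inj₁ (inj₁ (x , x∈ , inj₂ x↓))
    where
    a⪯u : pt a ⪯ pt u
    a⪯u = planar-cases i≢3 j≢3 i≢j (≤-reflexive aᵢ≡uᵢ) aⱼ≤uⱼ (≤-reflexive (trans a∈s (sym u∈s)))
    u∈ : InBox a b u
    u∈ = a⪯u , u⪯b

  planarDownAbove : pt a ⪯ pt b → (q : InvDown a b) →
    Outcome ⊎ Σ (L n) λ y → InBox a b y × DownOn Planar y × pt (upperFloor q) ⪯ pt y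
  planarDownAbove a⪯b (inj₁ (_ , Fsb⪯b)) = pure (b , (a⪯b , ⪯-refl) , DownOn-planar Fsb⪯b , ⪯-refl)
  planarDownAbove _ (inj₂ (d , (d∈s , _ , d₃≤Fd₃ , _ , i , j , i≢3 , j≢3 , i≢j ,
                                dᵢ≡bᵢ , dⱼ≤bⱼ , dⱼ≤Fdⱼ , Fbⱼ≤bⱼ) , a⪯d)) = do
    (y , y∈ , d⪯y , Fd⪯Fy , y-fixed) ←
      descend (_≟ j) d d∈ (λ { _ refl → dⱼ≤Fdⱼ }) b (⪯-trans a⪯d d⪯b , ⪯-refl) d⪯b (λ { _ refl → Fbⱼ≤bⱼ })
    let y₃≤Fy₃ = ≤-trans (≤-reflexive (trans (inBox-slice {y} y∈) (sym d∈s))) (≤-trans d₃≤Fd₃ (Fd⪯Fy c₃))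
    case FixedOn-axis⇒DownOn-planar⊎Up i≢3 j≢3 i≢j y-fixed y₃≤Fy₃ of λ where
      (inj₁ y↓) → pure (y , y∈ , y↓ , d⪯y)
      (inj₂ y↑) → inj₁ (inj₁ (y , y∈ , inj₁ y↑))
    where
    d⪯b : pt d ⪯ pt b
    d⪯b = planar-cases i≢3 j≢3 i≢j (≤-reflexive dᵢ≡bᵢ) dⱼ≤bⱼ (≤-reflexive (trans d∈s (sym b∈s)))
    d∈ : InBox a b d
    d∈ = a⪯d , d⪯b

lemma11 : (n : Fin 3 → ℕ) (f : L n → L n) (s₃ : ℕ) → 1 ≤ s₃ → s₃ ≤ n c₃ →
    (a b : L n) → Lattice.InSlice n f s₃ a → Lattice.InSlice n f s₃ b → pt a ⪯ pt b →
    Lattice.Invariant n f s₃ a b →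
    (Σ (L n) λ x → Lattice.InBox n f s₃ a b x × (Lattice.Up n f s₃ x ⊎ Lattice.Down n f s₃ x))
    ⊎ (Σ (L n) λ x → Σ (L n) λ y → Lattice.InBox n f s₃ a b x × Lattice.InBox n f s₃ a b y × Lattice.Violation n f s₃ x y)
-- The bounds on s₃ are implied by a ∈ L and a₃ = s₃.
lemma11 n f s₃ _ _ a b a∈s b∈s a⪯b (p , q , compat) = reduce do
  (x , x∈ , x↑ , x⪯ceiling) ← planarUpBelow a⪯b p
  (y , y∈ , y↓ , floor⪯y) ← planarDownAbove a⪯b q
  let x⪯y = ⪯-trans x⪯ceiling (⪯-trans (lowerCeiling⪯upperFloor a⪯b p q compat) floor⪯y)
  (x* , x*∈ , _ , _ , x*-fixed) ← ascend planar? y y∈ y↓ x x∈ x⪯y x↑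
  pure (inj₁ (x* , x*∈ , FixedOn-planar⇒Up⊎Down x*-fixed))
  where
  open Box n f s₃ a b a∈s b∈s
  open RawMonad (SumLeft.monad Outcome 0ℓ)
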